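{- For all $\lambda\mu$T-terms $t_1,t_2$: if $t_1=t_2$ in $\lambda\mu$T, then $t_1^*=t_2^*$ in $\lambda$T.
   Context: $\lambda$T: terms $t ::= x\mid\lambda x.r\mid ts\mid0\mid\mathsf S\,t\mid\mathsf{nrec}\ r\ s\ t$; reduction is the compatible closure of $(\lambda x.t)r\to t[x:=r]$, $\mathsf{nrec}\ r\ s\ 0\to r$, $\mathsf{nrec}\ r\ s\ (\mathsf S t)\to s\ t\ (\mathsf{nrec}\ r\ s\ t)$; $=$ is its reflexive–symmetric–transitive closure. $\lambda\mu$T: terms/commands $t ::= x\mid\lambda x.r\mid ts\mid\mu\alpha.c\mid0\mid\mathsf S\,t\mid\mathsf{nrec}\ r\ s\ t$, $c::=[\alpha]t$ ($\alpha$ a $\mu$-variable; $\mathrm{FCV}$ = free $\mu$-variables); numerals $\overline n:=\mathsf S^n0$; contexts $E ::= \Box \mid E\,t \mid \mathsf S\,E \mid \mathsf{nrec}\ r\ s\ E$; structural substitution $t[\alpha:=\beta E]$ replaces recursively every subcommand $[\alpha]q$ by $[\beta]E[q[\alpha:=\beta E]]$ (capture-avoiding). Reduction is the compatible closure of: $(\lambda x.t)r \to t[x:=r]$; $\mathsf S(\mu\alpha.c)\to \mu\alpha.c[\alpha:=\alpha(\mathsf S\Box)]$; $(\mu\alpha.c)s\to\mu\alpha.c[\alpha:=\alpha(\Box s)]$; $\mu\alpha.[\alpha]t\to t$ if $\alpha\notin\mathrm{FCV}(t)$; $[\alpha]\mu\beta.c\to c[\beta:=\alpha\,\Box]$; $\mathsf{nrec}\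 r\ s\ 0\to r$; $\mathsf{nrec}\ r\ s\ (\mathsf S\,\overline n)\to s\ \overline n\ (\mathsf{nrec}\ r\ s\ \overline n)$; $\mathsf{nrec}\ r\ s\ (\mu\alpha.c)\to\mu\alpha.c[\alpha:=\alpha(\mathsf{nrec}\ r\ s\ \Box)]$; $=$ is its reflexive–symmetric–transitive closure. CPS-translation into $\lambda$T: $t\bullet r:=\lambda k.t(\lambda l.lrk)$, $\overline{\overline{t}}:=\lambda k.kt$; each $\mu$-variable $\alpha$ has an associated fresh $\lambda$-variable $k_\alpha$; $x^*:=\lambda k.xk$; $(\lambda x.t)^*:=\lambda k.k(\lambda x.t^*)$; $(tr)^*:=t^*\bullet r^*$; $0^*:=\overline{\overline{0}}$; $(\mathsf S t)^*:=\lambda k.t^*(\lambda l.k(\mathsf S l))$; $(\mathsf{nrec}\ r\ s\ t)^*:=\lambda k.t^*(\lambda l.\mathsf{nrec}\ r^*\ s'\ l\ k)$ with $s':=\lambda xp.(s^*\bullet\overline{\overline{x}})\bullet p$; $(\mu\alpha.c)^*:=\lambda k_\alpha.c^*$; $([\alpha]t)^*:=t^*k_\alpha$. -}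

module Defs where

open import Data.Nat using (ℕ; zero; suc; _+_)
open import Data.Fin using (Fin; zero; suc; _↑ˡ_; _↑ʳ_)
import Data.Fin as F
open import Data.Product using (_×_; _,_; proj₁; proj₂)
open import Function using (id; _∘_)
open import Relation.Binary.Construct.Closure.Equivalence using (EqClosure)

ext : {n n' : ℕ} → (Fin n → Fin n') → Fin (suc n) → Fin (suc n')
ext ρ zero    = zero
ext ρ (suc i) = suc (ρ i)

data Tm (N : ℕ) : Set where
  var  : Fin N → Tm N
  lam  : Tm (suc N) → Tm N
  app  : Tm N → Tm N → Tm N
  zer  : Tm N
  S    : Tm N → Tm N
  nrec : Tm N → Tm N → Tm N → Tm N

ren : {N N' : ℕ} → (Fin N → Fin N') → Tm N → Tm N'
ren ρ (var x)        = var (ρ x)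
ren ρ (lam t)        = lam (ren (ext ρ) t)
ren ρ (app t s)      = app (ren ρ t) (ren ρ s)
ren ρ zer            = zer
ren ρ (S t)          = S (ren ρ t)
ren ρ (nrec r s t)   = nrec (ren ρ r) (ren ρ s) (ren ρ t)

wk : {N : ℕ} → Tm N → Tm (suc N)
wk = ren suc

exts : {N N' : ℕ} → (Fin N → Tm N') → Fin (suc N) → Tm (suc N')
exts σ zero    = var zero
exts σ (suc i) = wk (σ i)

sub : {N N' : ℕ} → (Fin N → Tm N') → Tm N → Tm N'
sub σ (var x)      = σ x
sub σ (lam t)      = lam (sub (exts σ) t)
sub σ (app t s)    = app (sub σ t) (sub σ s)
sub σ zer          = zer
sub σ (S t)        = S (sub σ t)
sub σ (nrec r s t) = nrec (sub σ r) (sub σ s) (sub σ t)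

sub0 : {N : ℕ} → Tm N → Fin (suc N) → Tm N
sub0 r zero    = r
sub0 r (suc i) = var i

_[_] : {N : ℕ} → Tm (suc N) → Tm N → Tm N
t [ r ] = sub (sub0 r) t

data _⟶_ {N : ℕ} : Tm N → Tm N → Set where
  β      : ∀ {t r} → app (lam t) r ⟶ (t [ r ])
  nrec0  : ∀ {r s} → nrec r s zer ⟶ r
  nrecS  : ∀ {r s t} → nrec r s (S t) ⟶ app (app s t) (nrec r s t)
  ξlam   : ∀ {t t'} → t ⟶ t' → lam t ⟶ lam t'
  ξappL  : ∀ {t t' s} → t ⟶ t' → app t s ⟶ app t' s
  ξappR  : ∀ {t s s'} → s ⟶ s' → app t s ⟶ app t s'
  ξS     : ∀ {t t'} → t ⟶ t' → S t ⟶ S t'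
  ξnrec₁ : ∀ {r r' s t} → r ⟶ r' → nrec r s t ⟶ nrec r' s t
  ξnrec₂ : ∀ {r s s' t} → s ⟶ s' → nrec r s t ⟶ nrec r s' t
  ξnrec₃ : ∀ {r s t t'} → t ⟶ t' → nrec r s t ⟶ nrec r s t'

_≈λ_ : {N : ℕ} → Tm N → Tm N → Set
_≈λ_ = EqClosure _⟶_

data Tmμ (n m : ℕ) : Set
data Cmd (n m : ℕ) : Set

data Tmμ n m where
  var  : Fin n → Tmμ n m
  lam  : Tmμ (suc n) m → Tmμ n m
  app  : Tmμ n m → Tmμ n m → Tmμ n m
  mu   : Cmd n (suc m) → Tmμ n m
  zer  : Tmμ n m
  S    : Tmμ n m → Tmμ n m
  nrec : Tmμ n m → Tmμ n m → Tmμ n m → Tmμ n m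

data Cmd n m where
  named : Fin m → Tmμ n m → Cmd n m

renμ  : {n n' m m' : ℕ} → (Fin n → Fin n') → (Fin m → Fin m') → Tmμ n m → Tmμ n' m'
renμC : {n n' m m' : ℕ} → (Fin n → Fin n') → (Fin m → Fin m') → Cmd n m → Cmd n' m'
renμ ρ κ (var x)      = var (ρ x)
renμ ρ κ (lam t)      = lam (renμ (ext ρ) κ t)
renμ ρ κ (app t s)    = app (renμ ρ κ t) (renμ ρ κ s)
renμ ρ κ (mu c)       = mu (renμC ρ (ext κ) c)
renμ ρ κ zer          = zer
renμ ρ κ (S t)        = S (renμ ρ κ t)
renμ ρ κ (nrec r s t) = nrec (renμ ρ κ r) (renμ ρ κ s) (renμ ρ κ t)
renμC ρ κ (named α t) = named (κ α) (renμ ρ κ t)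

wkμ : {n m : ℕ} → Tmμ n m → Tmμ n (suc m)
wkμ = renμ id suc

extsμ : {n n' m : ℕ} → (Fin n → Tmμ n' m) → Fin (suc n) → Tmμ (suc n') m
extsμ σ zero    = var zero
extsμ σ (suc i) = renμ suc id (σ i)

subμ  : {n n' m : ℕ} → (Fin n → Tmμ n' m) → Tmμ n m → Tmμ n' m
subμC : {n n' m : ℕ} → (Fin n → Tmμ n' m) → Cmd n m → Cmd n' m
subμ σ (var x)      = σ x
subμ σ (lam t)      = lam (subμ (extsμ σ) t)
subμ σ (app t s)    = app (subμ σ t) (subμ σ s)
subμ σ (mu c)       = mu (subμC (wkμ ∘ σ) c)
subμ σ zer          = zer
subμ σ (S t)        = S (subμ σ t)
subμ σ (nrec r s t) = nrec (subμ σ r) (subμ σ s) (subμ σ t)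
subμC σ (named α t) = named α (subμ σ t)

sub0μ : {n m : ℕ} → Tmμ n m → Fin (suc n) → Tmμ n m
sub0μ r zero    = r
sub0μ r (suc i) = var i

num : {n m : ℕ} → ℕ → Tmμ n m
num zero    = zer
num (suc k) = S (num k)

data Ctx (n m : ℕ) : Set where
  hole  : Ctx n m
  appC  : Ctx n m → Tmμ n m → Ctx n m
  SC    : Ctx n m → Ctx n m
  nrecC : Tmμ n m → Tmμ n m → Ctx n m → Ctx n m

plug : {n m : ℕ} → Ctx n m → Tmμ n m → Tmμ n m
plug hole          q = q
plug (appC E t)    q = app (plug E q) t
plug (SC E)        q = S (plug E q)
plug (nrecC r s E) q = nrec r s (plug E q)

renCtx : {n n' m m' : ℕ} → (Fin n → Fin n') → (Fin m → Fin m') → Ctx n m → Ctx n' m'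
renCtx ρ κ hole          = hole
renCtx ρ κ (appC E t)    = appC (renCtx ρ κ E) (renμ ρ κ t)
renCtx ρ κ (SC E)        = SC (renCtx ρ κ E)
renCtx ρ κ (nrecC r s E) = nrecC (renμ ρ κ r) (renμ ρ κ s) (renCtx ρ κ E)

-- Simultaneous structural substitution: each μ-variable α is sent to a
-- pair (β , E); every subcommand [α]q becomes [β]E[q'] (q' = q with the
-- substitution applied recursively).  The unary t[α:=βE] is the instance
-- sending α to (β , E) and every other μ-variable γ to (γ' , □).
SSub : ℕ → ℕ → ℕ → Set
SSub n m m' = Fin m → Fin m' × Ctx n m'

liftλ : {n m m' : ℕ} → SSub n m m' → SSub (suc n) m m'
liftλ σ α = proj₁ (σ α) , renCtx suc id (proj₂ (σ α))

liftμ : {n m m' : ℕ} → SSub n m m' → SSub n (suc m) (suc m')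
liftμ σ zero    = zero , hole
liftμ σ (suc α) = suc (proj₁ (σ α)) , renCtx id suc (proj₂ (σ α))

ssub  : {n m m' : ℕ} → SSub n m m' → Tmμ n m → Tmμ n m'
ssubC : {n m m' : ℕ} → SSub n m m' → Cmd n m → Cmd n m'
ssub σ (var x)      = var x
ssub σ (lam t)      = lam (ssub (liftλ σ) t)
ssub σ (app t s)    = app (ssub σ t) (ssub σ s)
ssub σ (mu c)       = mu (ssubC (liftμ σ) c)
ssub σ zer          = zer
ssub σ (S t)        = S (ssub σ t)
ssub σ (nrec r s t) = nrec (ssub σ r) (ssub σ s) (ssub σ t)
ssubC σ (named α t) = named (proj₁ (σ α)) (plug (proj₂ (σ α)) (ssub σ t))

-- c[α:=α E] for the outermost bound μ-variable α (index zero), E in scope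
-- of that variable
ssubSelf : {n m : ℕ} → Ctx n (suc m) → SSub n (suc m) (suc m)
ssubSelf E zero    = zero , E
ssubSelf E (suc γ) = suc γ , hole

-- c[β:=α □] for the outermost bound β (index zero), removing β
ssubTo : {n m : ℕ} → Fin m → SSub n (suc m) m
ssubTo α zero    = α , hole
ssubTo α (suc γ) = γ , hole

data _⟶μ_ {n m : ℕ} : Tmμ n m → Tmμ n m → Set
data _⟶c_ {n m : ℕ} : Cmd n m → Cmd n m → Set

data _⟶μ_ {n} {m} where
  β      : ∀ {t r} → app (lam t) r ⟶μ subμ (sub0μ r) t
  μS     : ∀ {c} → S (mu c) ⟶μ mu (ssubC (ssubSelf (SC hole)) c)
  μapp   : ∀ {c s} → app (mu c) s ⟶μ mu (ssubC (ssubSelf (appC hole (wkμ s))) c)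
  -- μα.[α]t → t  if α ∉ FCV(t), i.e. the body is a weakening of t
  μη     : ∀ {t} → mu (named zero (wkμ t)) ⟶μ t
  nrec0  : ∀ {r s} → nrec r s zer ⟶μ r
  nrecS  : ∀ {r s k} → nrec r s (S (num k)) ⟶μ app (app s (num k)) (nrec r s (num k))
  μnrec  : ∀ {r s c} → nrec r s (mu c) ⟶μ mu (ssubC (ssubSelf (nrecC (wkμ r) (wkμ s) hole)) c)
  ξlam   : ∀ {t t'} → t ⟶μ t' → lam t ⟶μ lam t'
  ξappL  : ∀ {t t' s} → t ⟶μ t' → app t s ⟶μ app t' s
  ξappR  : ∀ {t s s'} → s ⟶μ s' → app t s ⟶μ app t s'
  ξmu    : ∀ {c c'} → c ⟶c c' → mu c ⟶μ mu c'
  ξS     : ∀ {t t'} → t ⟶μ t' → S t ⟶μ S t'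
  ξnrec₁ : ∀ {r r' s t} → r ⟶μ r' → nrec r s t ⟶μ nrec r' s t
  ξnrec₂ : ∀ {r s s' t} → s ⟶μ s' → nrec r s t ⟶μ nrec r s' t
  ξnrec₃ : ∀ {r s t t'} → t ⟶μ t' → nrec r s t ⟶μ nrec r s t'

data _⟶c_ {n} {m} where
  μcmd   : ∀ {α c} → named α (mu c) ⟶c ssubC (ssubTo α) c
  ξnamed : ∀ {α t t'} → t ⟶μ t' → named α t ⟶c named α t'

_≈μ_ : {n m : ℕ} → Tmμ n m → Tmμ n m → Set
_≈μ_ = EqClosure _⟶μ_

-- t • r := λk. t (λl. l r k)
_•_ : {N : ℕ} → Tm N → Tm N → Tm N
t • r = lam (app (wk t) (lam (app (app (var zero) (wk (wk r))) (var (suc zero)))))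

dbl : {N : ℕ} → Tm N → Tm N
dbl t = lam (app (var zero) (wk t))

-- ρ : location of each λ-variable x; κ : location of k_α for each μ-variable α
cps  : {n m N : ℕ} → (Fin n → Fin N) → (Fin m → Fin N) → Tmμ n m → Tm N
cpsC : {n m N : ℕ} → (Fin n → Fin N) → (Fin m → Fin N) → Cmd n m → Tm N
cps ρ κ (var x)      = lam (app (var (suc (ρ x))) (var zero))
cps ρ κ (lam t)      = lam (app (var zero) (lam (cps (ext (F.suc ∘ ρ)) (F.suc ∘ F.suc ∘ κ) t)))
cps ρ κ (app t r)    = cps ρ κ t • cps ρ κ r
cps ρ κ (mu c)       = lam (cpsC (F.suc ∘ ρ) (ext κ) c)
cps ρ κ zer          = dbl zer
cps ρ κ (S t)        = lam (app (wk (cps ρ κ t)) (lam (app (var (suc zero)) (S (var zero)))))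
cps ρ κ (nrec r s t) =
  lam (app (wk (cps ρ κ t))
           (lam (app (nrec (wk (wk (cps ρ κ r))) (wk (wk s')) (var zero)) (var (suc zero)))))
  where
    -- s' := λx p. (s* • ⟦x⟧) • p
    s' = lam (lam ((wk (wk (cps ρ κ s)) • dbl (var (suc zero))) • var zero))
cpsC ρ κ (named α t) = app (cps ρ κ t) (var (κ α))

-- top-level translation: free λ-variables x_i and the λ-variables k_α
-- for the free μ-variables occupy disjoint positions of the scope n + m
_* : {n m : ℕ} → Tmμ n m → Tm (n + m)
_* {n} {m} t = cps (λ x → x ↑ˡ m) (λ α → n ↑ʳ α) t

module Submission where

-- Since convertibility is the equivalence closure of one-step reduction, it
-- suffices to show  t ⟶μ t'  ⇒  t * ≈λ t' *.  To make this go through under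
-- binders, the translation is generalised to an environment form  cpsᴱ ρ κ t,
-- where ρ x is the λT term standing for the λ-variable x and κ α is the
-- continuation standing for the μ-variable α;  _*  is the instance where both
-- environments are variables.

open import Defs
open import Data.Nat using (ℕ; zero; suc)
open import Data.Fin using (Fin; zero; suc; _↑ˡ_; _↑ʳ_)
open import Data.Product using (_,_; proj₁; proj₂; ∃)
open import Function using (_∘_)
open import Relation.Binary.PropositionalEquality
  using (_≡_; refl; sym; trans; cong; cong₂; subst; subst₂; _≗_)
open import Relation.Binary.Construct.Closure.Equivalence
  using (gmap; gfold; isEquivalence; symmetric; setoid)
open import Relation.Binary.Construct.Closure.ReflexiveTransitive using (ε; _◅_; _◅◅_)
open import Relation.Binary.Construct.Closure.Symmetric using (fwd)
import Relation.Binary.Reasoning.Setoid as SetoidReasoning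

cong₃ : {A B C D : Set} (f : A → B → C → D) {a a' : A} {b b' : B} {c c' : C} →
        a ≡ a' → b ≡ b' → c ≡ c' → f a b c ≡ f a' b' c'
cong₃ f refl refl refl = refl

-- 1. Substitution calculus of λT

ren-ren : ∀ {N N' N''} {π : Fin N' → Fin N''} {π' : Fin N → Fin N'} {π'' : Fin N → Fin N''}
  → π'' ≗ π ∘ π' → ∀ t → ren π (ren π' t) ≡ ren π'' t
ren-ren h (var x) = cong var (sym (h x))
ren-ren {π = π} {π'} {π''} h (lam t) = cong lam (ren-ren h' t)
  where h' : ext π'' ≗ ext π ∘ ext π'
        h' zero = refl
        h' (suc i) = cong suc (h i)
ren-ren h (app t s) = cong₂ app (ren-ren h t) (ren-ren h s)
ren-ren h zer = refl
ren-ren h (S t) = cong S (ren-ren h t)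
ren-ren h (nrec r s t) = cong₃ nrec (ren-ren h r) (ren-ren h s) (ren-ren h t)

ren≡sub : ∀ {N N'} {π : Fin N → Fin N'} {σ : Fin N → Tm N'} → σ ≗ var ∘ π → ∀ t → ren π t ≡ sub σ t
ren≡sub h (var x) = sym (h x)
ren≡sub {π = π} {σ} h (lam t) = cong lam (ren≡sub h' t)
  where h' : exts σ ≗ var ∘ ext π
        h' zero = refl
        h' (suc i) = cong wk (h i)
ren≡sub h (app t s) = cong₂ app (ren≡sub h t) (ren≡sub h s)
ren≡sub h zer = refl
ren≡sub h (S t) = cong S (ren≡sub h t)
ren≡sub h (nrec r s t) = cong₃ nrec (ren≡sub h r) (ren≡sub h s) (ren≡sub h t)

sub-ren : ∀ {N N' N''} {σ : Fin N' → Tm N''} {π : Fin N → Fin N'} {σ' : Fin N → Tm N''}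
  → σ' ≗ σ ∘ π → ∀ t → sub σ (ren π t) ≡ sub σ' t
sub-ren h (var x) = sym (h x)
sub-ren {σ = σ} {π} {σ'} h (lam t) = cong lam (sub-ren h' t)
  where h' : exts σ' ≗ exts σ ∘ ext π
        h' zero = refl
        h' (suc i) = cong wk (h i)
sub-ren h (app t s) = cong₂ app (sub-ren h t) (sub-ren h s)
sub-ren h zer = refl
sub-ren h (S t) = cong S (sub-ren h t)
sub-ren h (nrec r s t) = cong₃ nrec (sub-ren h r) (sub-ren h s) (sub-ren h t)

ren-sub : ∀ {N N' N''} {π : Fin N' → Fin N''} {σ : Fin N → Tm N'} {σ' : Fin N → Tm N''}
  → σ' ≗ ren π ∘ σ → ∀ t → ren π (sub σ t) ≡ sub σ' t
ren-sub h (var x) = sym (h x)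
ren-sub {π = π} {σ} {σ'} h (lam t) = cong lam (ren-sub h' t)
  where h' : exts σ' ≗ ren (ext π) ∘ exts σ
        h' zero = refl
        h' (suc i) = trans (cong wk (h i))
                       (trans (ren-ren (λ _ → refl) (σ i)) (sym (ren-ren (λ _ → refl) (σ i))))
ren-sub h (app t s) = cong₂ app (ren-sub h t) (ren-sub h s)
ren-sub h zer = refl
ren-sub h (S t) = cong S (ren-sub h t)
ren-sub h (nrec r s t) = cong₃ nrec (ren-sub h r) (ren-sub h s) (ren-sub h t)

sub-sub : ∀ {N N' N''} {σ : Fin N' → Tm N''} {τ : Fin N → Tm N'} {σ' : Fin N → Tm N''}
  → σ' ≗ sub σ ∘ τ → ∀ t → sub σ (sub τ t) ≡ sub σ' t
sub-sub h (var x) = sym (h x)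
sub-sub {σ = σ} {τ} {σ'} h (lam t) = cong lam (sub-sub h' t)
  where h' : exts σ' ≗ sub (exts σ) ∘ exts τ
        h' zero = refl
        h' (suc i) = trans (cong wk (h i))
                       (trans (ren-sub (λ _ → refl) (τ i)) (sym (sub-ren (λ _ → refl) (τ i))))
sub-sub h (app t s) = cong₂ app (sub-sub h t) (sub-sub h s)
sub-sub h zer = refl
sub-sub h (S t) = cong S (sub-sub h t)
sub-sub h (nrec r s t) = cong₃ nrec (sub-sub h r) (sub-sub h s) (sub-sub h t)

sub-id : ∀ {N} {σ : Fin N → Tm N} → σ ≗ var → ∀ t → sub σ t ≡ t
sub-id h (var x) = h x
sub-id {σ = σ} h (lam t) = cong lam (sub-id h' t)
  where h' : exts σ ≗ var
        h' zero = refl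
        h' (suc i) = cong wk (h i)
sub-id h (app t s) = cong₂ app (sub-id h t) (sub-id h s)
sub-id h zer = refl
sub-id h (S t) = cong S (sub-id h t)
sub-id h (nrec r s t) = cong₃ nrec (sub-id h r) (sub-id h s) (sub-id h t)

shift : ∀ {N} → Fin N → Tm (suc N)
shift i = var (suc i)

wk≡sub : ∀ {N} (X : Tm N) → wk X ≡ sub shift X
wk≡sub = ren≡sub (λ _ → refl)

sub-exts-wk : ∀ {N N'} (τ : Fin N → Tm N') (X : Tm N) → sub (exts τ) (wk X) ≡ wk (sub τ X)
sub-exts-wk τ X = trans (sub-ren (λ _ → refl) X) (sym (ren-sub (λ _ → refl) X))

sub-exts²-wk² : ∀ {N N'} (τ : Fin N → Tm N') (X : Tm N) →
  sub (exts (exts τ)) (wk (wk X)) ≡ wk (wk (sub τ X))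
sub-exts²-wk² τ X = trans (sub-exts-wk (exts τ) (wk X)) (cong wk (sub-exts-wk τ X))

sub0-wk : ∀ {N} (k X : Tm N) → sub (sub0 k) (wk X) ≡ X
sub0-wk k X = trans (sub-ren (λ _ → refl) X) (sub-id (λ _ → refl) X)

sub0-wk² : ∀ {N} (k X : Tm N) → sub (exts (sub0 k)) (wk (wk X)) ≡ wk X
sub0-wk² k X = trans (sub-exts-wk (sub0 k) (wk X)) (cong wk (sub0-wk k X))

sub-sub0 : ∀ {N N'} (σ : Fin N → Tm N') (t : Tm (suc N)) (r : Tm N) →
  sub (sub0 (sub σ r)) (sub (exts σ) t) ≡ sub σ (t [ r ])
sub-sub0 σ t r = trans (sub-sub h t) (sym (sub-sub (λ _ → refl) t))
  where
    h : (sub σ ∘ sub0 r) ≗ sub (sub0 (sub σ r)) ∘ exts σ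
    h zero = refl
    h (suc i) = sym (sub0-wk _ (σ i))

-- [k/0] without removing the variable 0, used for β-steps under a binder.
replace₀ : ∀ {N} → Tm (suc N) → Fin (suc N) → Tm (suc N)
replace₀ k zero = k
replace₀ k (suc i) = var (suc i)

replace₀-wk : ∀ {N} (k : Tm (suc N)) (X : Tm N) → sub (replace₀ k) (wk X) ≡ wk X
replace₀-wk k X = trans (sub-ren (λ _ → refl) X) (sym (wk≡sub X))

-- 2. Convertibility in λT

-- _≈λ_ is a reflexive–transitive closure, so  ε  is reflexivity and  _◅◅_
-- is transitivity; chains are written with setoid reasoning.
module ≈-Reasoning {N : ℕ} = SetoidReasoning (setoid (_⟶_ {N}))

≈-step : ∀ {N} {a b : Tm N} → a ⟶ b → a ≈λ b
≈-step p = fwd p ◅ ε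

≈-sym : ∀ {N} {a b : Tm N} → a ≈λ b → b ≈λ a
≈-sym = symmetric _⟶_

≡⇒≈ : ∀ {N} {a b : Tm N} → a ≡ b → a ≈λ b
≡⇒≈ refl = ε

βeq : ∀ {N} {b : Tm (suc N)} {r z : Tm N} → sub (sub0 r) b ≡ z → app (lam b) r ≈λ z
βeq {b = b} {r} eq = ≈-step (subst (app (lam b) r ⟶_) eq β)

wkβ : ∀ {N} (B K : Tm (suc N)) → app (wk (lam B)) K ≈λ sub (replace₀ K) B
wkβ B K = βeq (sub-ren h B)
  where h : replace₀ K ≗ sub0 K ∘ ext suc
        h zero = refl
        h (suc i) = refl

sub-⟶ : ∀ {N N'} (σ : Fin N → Tm N') {t t' : Tm N} → t ⟶ t' → sub σ t ⟶ sub σ t'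
sub-⟶ σ (β {t} {r}) = subst (sub σ (app (lam t) r) ⟶_) (sub-sub0 σ t r) β
sub-⟶ σ nrec0 = nrec0
sub-⟶ σ nrecS = nrecS
sub-⟶ σ (ξlam p) = ξlam (sub-⟶ (exts σ) p)
sub-⟶ σ (ξappL p) = ξappL (sub-⟶ σ p)
sub-⟶ σ (ξappR p) = ξappR (sub-⟶ σ p)
sub-⟶ σ (ξS p) = ξS (sub-⟶ σ p)
sub-⟶ σ (ξnrec₁ p) = ξnrec₁ (sub-⟶ σ p)
sub-⟶ σ (ξnrec₂ p) = ξnrec₂ (sub-⟶ σ p)
sub-⟶ σ (ξnrec₃ p) = ξnrec₃ (sub-⟶ σ p)

≈-wk : ∀ {N} {t t' : Tm N} → t ≈λ t' → wk t ≈λ wk t'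
≈-wk {t = t} {t'} p =
  subst₂ _≈λ_ (sym (wk≡sub t)) (sym (wk≡sub t')) (gmap (sub shift) (sub-⟶ _) p)

lam-cong : ∀ {N} {t t' : Tm (suc N)} → t ≈λ t' → lam t ≈λ lam t'
lam-cong = gmap lam ξlam

app-congL : ∀ {N} {t t' s : Tm N} → t ≈λ t' → app t s ≈λ app t' s
app-congL {s = s} = gmap (λ z → app z s) ξappL

app-congR : ∀ {N} {t s s' : Tm N} → s ≈λ s' → app t s ≈λ app t s'
app-congR {t = t} = gmap (app t) ξappR

app-cong : ∀ {N} {t t' s s' : Tm N} → t ≈λ t' → s ≈λ s' → app t s ≈λ app t' s'
app-cong p q = app-congL p ◅◅ app-congR q

nrec-cong : ∀ {N} {r r' s s' t t' : Tm N} → r ≈λ r' → s ≈λ s' → t ≈λ t' → nrec r s t ≈λ nrec r' s' t'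
nrec-cong {r' = r'} {s} {s'} {t} p q w =
  gmap (λ z → nrec z s t) ξnrec₁ p ◅◅ gmap (λ z → nrec r' z t) ξnrec₂ q ◅◅ gmap (nrec r' s') ξnrec₃ w

-- 3. The CPS combinators and numerals

nrecStep : ∀ {N} → Tm N → Tm N
nrecStep s = lam (lam ((wk (wk s) • dbl (var (suc zero))) • var zero))

-- η-expansion λk. X k; a λ-variable x is translated to the η-expansion of x.
η-exp : ∀ {N} → Tm N → Tm N
η-exp X = lam (app (wk X) (var zero))

sub-• : ∀ {N N'} (τ : Fin N → Tm N') (A B : Tm N) → sub τ (A • B) ≡ sub τ A • sub τ B
sub-• τ A B = cong₂ (λ a b → lam (app a (lam (app (app (var zero) b) (var (suc zero))))))
                (sub-exts-wk τ A) (sub-exts²-wk² τ B)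

sub-dbl : ∀ {N N'} (τ : Fin N → Tm N') (A : Tm N) → sub τ (dbl A) ≡ dbl (sub τ A)
sub-dbl τ A = cong (λ a → lam (app (var zero) a)) (sub-exts-wk τ A)

sub-η-exp : ∀ {N N'} (τ : Fin N → Tm N') (A : Tm N) → sub τ (η-exp A) ≡ η-exp (sub τ A)
sub-η-exp τ A = cong (λ a → lam (app a (var zero))) (sub-exts-wk τ A)

sub-nrecStep : ∀ {N N'} (τ : Fin N → Tm N') (A : Tm N) → sub τ (nrecStep A) ≡ nrecStep (sub τ A)
sub-nrecStep τ A = cong (λ z → lam (lam z))
  (trans (sub-• τ₂ (wk (wk A) • dbl (var (suc zero))) (var zero))
    (cong (_• var zero)
      (trans (sub-• τ₂ (wk (wk A)) (dbl (var (suc zero))))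
        (cong₂ _•_ (sub-exts²-wk² τ A) (sub-dbl τ₂ (var (suc zero)))))))
  where τ₂ = exts (exts τ)

wk-η-exp : ∀ {N} (X : Tm N) → wk (η-exp X) ≡ η-exp (wk X)
wk-η-exp X = trans (wk≡sub (η-exp X)) (trans (sub-η-exp _ X) (sym (cong η-exp (wk≡sub X))))

wk-dbl : ∀ {N} (A : Tm N) → wk (dbl A) ≡ dbl (wk A)
wk-dbl A = trans (wk≡sub (dbl A)) (trans (sub-dbl _ A) (sym (cong dbl (wk≡sub A))))

wk-nrecStep : ∀ {N} (A : Tm N) → wk (nrecStep A) ≡ nrecStep (wk A)
wk-nrecStep A = trans (wk≡sub (nrecStep A)) (trans (sub-nrecStep _ A) (sym (cong nrecStep (wk≡sub A))))

•-cong : ∀ {N} {A A' B B' : Tm N} → A ≈λ A' → B ≈λ B' → (A • B) ≈λ (A' • B')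
•-cong p q = lam-cong (app-cong (≈-wk p) (lam-cong (app-congL (app-congR (≈-wk (≈-wk q))))))

η-exp-cong : ∀ {N} {A A' : Tm N} → A ≈λ A' → η-exp A ≈λ η-exp A'
η-exp-cong p = lam-cong (app-congL (≈-wk p))

nrecStep-cong : ∀ {N} {A A' : Tm N} → A ≈λ A' → nrecStep A ≈λ nrecStep A'
nrecStep-cong p = lam-cong (lam-cong (•-cong (•-cong (≈-wk (≈-wk p)) ε) ε))

dbl-β : ∀ {N} (v K : Tm N) → app (dbl v) K ≈λ app K v
dbl-β v K = βeq (cong (app K) (sub0-wk K v))

nrecStep-β : ∀ {N} (A x y : Tm N) → app (app (nrecStep A) x) y ≈λ ((A • dbl x) • y)
nrecStep-β A x y =
  app-congL (≈-step β) ◅◅ ≈-step β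
  ◅◅ ≡⇒≈ (trans (sub-sub (λ _ → refl) B)
          (trans (sub-• φ (wk (wk A) • dbl (var (suc zero))) (var zero))
            (cong (_• y) (trans (sub-• φ (wk (wk A)) (dbl (var (suc zero))))
              (cong₂ _•_ φ-A (trans (sub-dbl φ (var (suc zero))) (cong dbl (sub0-wk y x))))))))
  where
    B = (wk (wk A) • dbl (var (suc zero))) • var zero
    φ = λ i → sub (sub0 y) (exts (sub0 x) i)
    φ-A : sub φ (wk (wk A)) ≡ A
    φ-A = trans (sub-ren (λ _ → refl) (wk A)) (trans (sub-ren (λ _ → refl) A) (sub-id (λ _ → refl) A))

-- η-expanding an abstraction is a β-step in reverse.
η-exp-lam : ∀ {N} (b : Tm (suc N)) → η-exp (lam b) ≈λ lam b
η-exp-lam b = lam-cong (βeq (trans (sub-ren (λ _ → refl) b) (sub-id h b)))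
  where h : (sub0 (var zero) ∘ ext suc) ≗ var
        h zero = refl
        h (suc i) = refl

η-exp-≈lam : ∀ {N} {X : Tm N} (b : Tm (suc N)) → X ≈λ lam b → η-exp X ≈λ X
η-exp-≈lam b p = η-exp-cong p ◅◅ η-exp-lam b ◅◅ ≈-sym p

numeral : ∀ {N} → ℕ → Tm N
numeral zero = zer
numeral (suc k) = S (numeral k)

sub-numeral : ∀ {N N'} (σ : Fin N → Tm N') k → sub σ (numeral k) ≡ numeral k
sub-numeral σ zero = refl
sub-numeral σ (suc k) = cong S (sub-numeral σ k)

wk-numeral : ∀ {N} k → wk {N} (numeral k) ≡ numeral k
wk-numeral k = trans (wk≡sub (numeral k)) (sub-numeral _ k)

nrec-numeral-lam : ∀ {N} (R A : Tm N) (b : Tm (suc N)) k → R ≡ lam b →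
  ∃ λ b' → nrec R (nrecStep A) (numeral k) ≈λ lam b'
nrec-numeral-lam R A b zero eq = b , ≈-step nrec0 ◅◅ ≡⇒≈ eq
nrec-numeral-lam R A b (suc k) eq = _ , (≈-step nrecS ◅◅ nrecStep-β A (numeral k) _)

-- 4. The CPS translation in environment form

-- Environments for the two binders a translation may go under: a
-- λ-abstraction binds k and then x (x is the newest variable), a μ-abstraction
-- binds k_α (the newest variable).
extVal : ∀ {n N} → (Fin n → Tm N) → Fin (suc n) → Tm (suc (suc N))
extVal ρ zero = var zero
extVal ρ (suc i) = wk (wk (ρ i))

extCont : ∀ {m N} → (Fin m → Tm N) → Fin (suc m) → Tm (suc N)
extCont κ zero = var zero
extCont κ (suc α) = wk (κ α)

infixr 5 _▸_
_▸_ : ∀ {n N} → Tm N → (Fin n → Tm N) → Fin (suc n) → Tm N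
(R ▸ ρ) zero = R
(R ▸ ρ) (suc i) = ρ i

-- cpsᴱ ρ κ t: the clauses of cps, with x ↦ η-exp (ρ x) and k_α ↦ κ α.
cpsᴱ  : ∀ {n m N} → (Fin n → Tm N) → (Fin m → Tm N) → Tmμ n m → Tm N
cpsᴱC : ∀ {n m N} → (Fin n → Tm N) → (Fin m → Tm N) → Cmd n m → Tm N
cpsᴱ ρ κ (var x) = η-exp (ρ x)
cpsᴱ ρ κ (lam t) = lam (app (var zero) (lam (cpsᴱ (extVal ρ) (wk ∘ wk ∘ κ) t)))
cpsᴱ ρ κ (app t r) = cpsᴱ ρ κ t • cpsᴱ ρ κ r
cpsᴱ ρ κ (mu c) = lam (cpsᴱC (wk ∘ ρ) (extCont κ) c)
cpsᴱ ρ κ zer = dbl zer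
cpsᴱ ρ κ (S t) = lam (app (wk (cpsᴱ ρ κ t)) (lam (app (var (suc zero)) (S (var zero)))))
cpsᴱ ρ κ (nrec r s t) =
  lam (app (wk (cpsᴱ ρ κ t))
           (lam (app (nrec (wk (wk (cpsᴱ ρ κ r))) (wk (wk (nrecStep (cpsᴱ ρ κ s)))) (var zero))
                     (var (suc zero)))))
cpsᴱC ρ κ (named α t) = app (cpsᴱ ρ κ t) (κ α)

cps≡cpsᴱ  : ∀ {n m N} {ρ : Fin n → Fin N} {κ : Fin m → Fin N} {ρ' : Fin n → Tm N} {κ' : Fin m → Tm N}
  → ρ' ≗ var ∘ ρ → κ' ≗ var ∘ κ → ∀ t → cps ρ κ t ≡ cpsᴱ ρ' κ' t
cpsC≡cpsᴱC : ∀ {n m N} {ρ : Fin n → Fin N} {κ : Fin m → Fin N} {ρ' : Fin n → Tm N} {κ' : Fin m → Tm N}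
  → ρ' ≗ var ∘ ρ → κ' ≗ var ∘ κ → ∀ c → cpsC ρ κ c ≡ cpsᴱC ρ' κ' c
cps≡cpsᴱ hρ hκ (var x) = cong η-exp (sym (hρ x))
cps≡cpsᴱ {ρ = ρ} {κ} {ρ'} {κ'} hρ hκ (lam t) = cong (λ z → lam (app (var zero) (lam z))) (cps≡cpsᴱ h1 h2 t)
  where h1 : extVal ρ' ≗ (λ i → Tm.var (ext (λ j → Fin.suc (ρ j)) i))
        h1 zero = refl
        h1 (suc i) = cong (wk ∘ wk) (hρ i)
        h2 : (wk ∘ wk ∘ κ') ≗ (λ i → Tm.var {suc (suc _)} (Fin.suc (Fin.suc (κ i))))
        h2 i = cong (wk ∘ wk) (hκ i)
cps≡cpsᴱ hρ hκ (app t r) = cong₂ _•_ (cps≡cpsᴱ hρ hκ t) (cps≡cpsᴱ hρ hκ r)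
cps≡cpsᴱ {ρ = ρ} {κ} {ρ'} {κ'} hρ hκ (mu c) = cong lam (cpsC≡cpsᴱC h1 h2 c)
  where h1 : (wk ∘ ρ') ≗ (λ i → Tm.var {suc _} (Fin.suc (ρ i)))
        h1 i = cong wk (hρ i)
        h2 : extCont κ' ≗ (λ i → Tm.var (ext κ i))
        h2 zero = refl
        h2 (suc i) = cong wk (hκ i)
cps≡cpsᴱ hρ hκ zer = refl
cps≡cpsᴱ hρ hκ (S t) =
  cong (λ z → lam (app (wk z) (lam (app (var (suc zero)) (S (var zero)))))) (cps≡cpsᴱ hρ hκ t)
cps≡cpsᴱ hρ hκ (nrec r s t) =
  cong₃ (λ a b c → lam (app (wk a) (lam (app (nrec (wk (wk b)) (wk (wk (nrecStep c))) (var zero)) (var (suc zero))))))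
    (cps≡cpsᴱ hρ hκ t) (cps≡cpsᴱ hρ hκ r) (cps≡cpsᴱ hρ hκ s)
cpsC≡cpsᴱC hρ hκ (named α t) = cong₂ app (cps≡cpsᴱ hρ hκ t) (sym (hκ α))

sub-cpsᴱ  : ∀ {n m N N'} {τ : Fin N → Tm N'} {ρ : Fin n → Tm N} {κ : Fin m → Tm N}
  {ρ' : Fin n → Tm N'} {κ' : Fin m → Tm N'}
  → ρ' ≗ sub τ ∘ ρ → κ' ≗ sub τ ∘ κ → ∀ t → sub τ (cpsᴱ ρ κ t) ≡ cpsᴱ ρ' κ' t
sub-cpsᴱC : ∀ {n m N N'} {τ : Fin N → Tm N'} {ρ : Fin n → Tm N} {κ : Fin m → Tm N}
  {ρ' : Fin n → Tm N'} {κ' : Fin m → Tm N'}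
  → ρ' ≗ sub τ ∘ ρ → κ' ≗ sub τ ∘ κ → ∀ c → sub τ (cpsᴱC ρ κ c) ≡ cpsᴱC ρ' κ' c
sub-cpsᴱ {τ = τ} {ρ} hρ hκ (var x) = trans (sub-η-exp τ (ρ x)) (cong η-exp (sym (hρ x)))
sub-cpsᴱ {τ = τ} {ρ} {κ} {ρ'} {κ'} hρ hκ (lam t) =
  cong (λ z → lam (app (var zero) (lam z))) (sub-cpsᴱ h1 h2 t)
  where h1 : extVal ρ' ≗ sub (exts (exts τ)) ∘ extVal ρ
        h1 zero = refl
        h1 (suc i) = trans (cong (wk ∘ wk) (hρ i)) (sym (sub-exts²-wk² τ (ρ i)))
        h2 : (wk ∘ wk ∘ κ') ≗ sub (exts (exts τ)) ∘ (wk ∘ wk ∘ κ)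
        h2 i = trans (cong (wk ∘ wk) (hκ i)) (sym (sub-exts²-wk² τ (κ i)))
sub-cpsᴱ {τ = τ} {ρ} {κ} hρ hκ (app t r) =
  trans (sub-• τ (cpsᴱ ρ κ t) (cpsᴱ ρ κ r)) (cong₂ _•_ (sub-cpsᴱ hρ hκ t) (sub-cpsᴱ hρ hκ r))
sub-cpsᴱ {τ = τ} {ρ} {κ} {ρ'} {κ'} hρ hκ (mu c) = cong lam (sub-cpsᴱC h1 h2 c)
  where h1 : (wk ∘ ρ') ≗ sub (exts τ) ∘ (wk ∘ ρ)
        h1 i = trans (cong wk (hρ i)) (sym (sub-exts-wk τ (ρ i)))
        h2 : extCont κ' ≗ sub (exts τ) ∘ extCont κ
        h2 zero = refl
        h2 (suc i) = trans (cong wk (hκ i)) (sym (sub-exts-wk τ (κ i)))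
sub-cpsᴱ hρ hκ zer = refl
sub-cpsᴱ {τ = τ} {ρ} {κ} hρ hκ (S t) =
  cong (λ z → lam (app z (lam (app (var (suc zero)) (S (var zero))))))
    (trans (sub-exts-wk τ (cpsᴱ ρ κ t)) (cong wk (sub-cpsᴱ hρ hκ t)))
sub-cpsᴱ {τ = τ} {ρ} {κ} hρ hκ (nrec r s t) =
  cong₃ (λ a b c → lam (app a (lam (app (nrec b c (var zero)) (var (suc zero))))))
    (trans (sub-exts-wk τ (cpsᴱ ρ κ t)) (cong wk (sub-cpsᴱ hρ hκ t)))
    (trans (sub-exts²-wk² τ (cpsᴱ ρ κ r)) (cong (wk ∘ wk) (sub-cpsᴱ hρ hκ r)))
    (trans (sub-exts²-wk² τ (nrecStep (cpsᴱ ρ κ s)))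
           (cong (wk ∘ wk) (trans (sub-nrecStep τ (cpsᴱ ρ κ s)) (cong nrecStep (sub-cpsᴱ hρ hκ s)))))
sub-cpsᴱC hρ hκ (named α t) = cong₂ app (sub-cpsᴱ hρ hκ t) (sym (hκ α))

wk-cpsᴱ : ∀ {n m N} (ρ : Fin n → Tm N) (κ : Fin m → Tm N) t →
  wk (cpsᴱ ρ κ t) ≡ cpsᴱ (wk ∘ ρ) (wk ∘ κ) t
wk-cpsᴱ ρ κ t = trans (wk≡sub (cpsᴱ ρ κ t)) (sub-cpsᴱ (λ x → wk≡sub (ρ x)) (λ α → wk≡sub (κ α)) t)

cpsᴱ-renμ  : ∀ {n n' m m' N} {π : Fin n → Fin n'} {θ : Fin m → Fin m'}
  {ρ : Fin n' → Tm N} {κ : Fin m' → Tm N} {ρ' : Fin n → Tm N} {κ' : Fin m → Tm N}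
  → ρ' ≗ ρ ∘ π → κ' ≗ κ ∘ θ → ∀ t → cpsᴱ ρ κ (renμ π θ t) ≡ cpsᴱ ρ' κ' t
cpsᴱC-renμ : ∀ {n n' m m' N} {π : Fin n → Fin n'} {θ : Fin m → Fin m'}
  {ρ : Fin n' → Tm N} {κ : Fin m' → Tm N} {ρ' : Fin n → Tm N} {κ' : Fin m → Tm N}
  → ρ' ≗ ρ ∘ π → κ' ≗ κ ∘ θ → ∀ c → cpsᴱC ρ κ (renμC π θ c) ≡ cpsᴱC ρ' κ' c
cpsᴱ-renμ hρ hκ (var x) = cong η-exp (sym (hρ x))
cpsᴱ-renμ {π = π} {θ} {ρ} {κ} {ρ'} {κ'} hρ hκ (lam t) =
  cong (λ z → lam (app (var zero) (lam z))) (cpsᴱ-renμ h1 h2 t)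
  where h1 : extVal ρ' ≗ extVal ρ ∘ ext π
        h1 zero = refl
        h1 (suc i) = cong (wk ∘ wk) (hρ i)
        h2 : (wk ∘ wk ∘ κ') ≗ (wk ∘ wk ∘ κ) ∘ θ
        h2 i = cong (wk ∘ wk) (hκ i)
cpsᴱ-renμ hρ hκ (app t r) = cong₂ _•_ (cpsᴱ-renμ hρ hκ t) (cpsᴱ-renμ hρ hκ r)
cpsᴱ-renμ {π = π} {θ} {ρ} {κ} {ρ'} {κ'} hρ hκ (mu c) = cong lam (cpsᴱC-renμ h1 h2 c)
  where h1 : (wk ∘ ρ') ≗ (wk ∘ ρ) ∘ π
        h1 i = cong wk (hρ i)
        h2 : extCont κ' ≗ extCont κ ∘ ext θ
        h2 zero = refl
        h2 (suc i) = cong wk (hκ i)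
cpsᴱ-renμ hρ hκ zer = refl
cpsᴱ-renμ hρ hκ (S t) =
  cong (λ z → lam (app (wk z) (lam (app (var (suc zero)) (S (var zero)))))) (cpsᴱ-renμ hρ hκ t)
cpsᴱ-renμ hρ hκ (nrec r s t) =
  cong₃ (λ a b c → lam (app (wk a) (lam (app (nrec (wk (wk b)) (wk (wk (nrecStep c))) (var zero)) (var (suc zero))))))
    (cpsᴱ-renμ hρ hκ t) (cpsᴱ-renμ hρ hκ r) (cpsᴱ-renμ hρ hκ s)
cpsᴱC-renμ hρ hκ (named α t) = cong₂ app (cpsᴱ-renμ hρ hκ t) (sym (hκ α))

cpsᴱ-wkμ : ∀ {n m N} (ρ : Fin n → Tm N) (κ : Fin m → Tm N) t →
  cpsᴱ (wk ∘ ρ) (extCont κ) (wkμ t) ≡ wk (cpsᴱ ρ κ t)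
cpsᴱ-wkμ ρ κ t = trans (cpsᴱ-renμ (λ _ → refl) (λ _ → refl) t) (sym (wk-cpsᴱ ρ κ t))

cpsᴱ-lam : ∀ {n m N} (ρ : Fin n → Tm N) (κ : Fin m → Tm N) t → ∃ λ b → cpsᴱ ρ κ t ≡ lam b
cpsᴱ-lam ρ κ (var x) = _ , refl
cpsᴱ-lam ρ κ (lam t) = _ , refl
cpsᴱ-lam ρ κ (app t r) = _ , refl
cpsᴱ-lam ρ κ (mu c) = _ , refl
cpsᴱ-lam ρ κ zer = _ , refl
cpsᴱ-lam ρ κ (S t) = _ , refl
cpsᴱ-lam ρ κ (nrec r s t) = _ , refl

η-exp-cpsᴱ : ∀ {n m N} (ρ : Fin n → Tm N) (κ : Fin m → Tm N) t → η-exp (cpsᴱ ρ κ t) ≈λ cpsᴱ ρ κ t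
η-exp-cpsᴱ ρ κ t = η-exp-≈lam (proj₁ (cpsᴱ-lam ρ κ t)) (≡⇒≈ (proj₂ (cpsᴱ-lam ρ κ t)))

cpsᴱ-num : ∀ {n m N} (ρ : Fin n → Tm N) (κ : Fin m → Tm N) k → cpsᴱ ρ κ (num k) ≈λ dbl (numeral k)
cpsᴱ-num ρ κ zero = ε
cpsᴱ-num ρ κ (suc k) = lam-cong (begin
    app (wk (cpsᴱ ρ κ (num k))) succ-k  ≈⟨ app-congL (≈-wk (cpsᴱ-num ρ κ k)) ⟩
    app (wk (dbl (numeral k))) succ-k   ≡⟨ cong (λ z → app z succ-k) (trans (wk-dbl _) (cong dbl (wk-numeral k))) ⟩
    app (dbl (numeral k)) succ-k        ≈⟨ dbl-β (numeral k) succ-k ⟩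
    app succ-k (numeral k)              ≈⟨ ≈-step β ⟩
    app (var zero) (S (numeral k))      ≡⟨ cong (λ z → app (var zero) (S z)) (wk-numeral k) ⟨
    app (var zero) (wk (S (numeral k))) ∎)
  where
    open ≈-Reasoning
    succ-k = lam (app (var (suc zero)) (S (var zero)))

-- 5. Substitution lemmas for the translation

-- λ-substitution: substituting σ x for x amounts to taking a value ρ' x
-- whose η-expansion (the translation of a variable) is convertible to the
-- translation of σ x.
cpsᴱ-subμ  : ∀ {n n' m N} (σ : Fin n → Tmμ n' m) (ρ : Fin n' → Tm N) (ρ' : Fin n → Tm N) (κ : Fin m → Tm N)
  → (∀ x → η-exp (ρ' x) ≈λ cpsᴱ ρ κ (σ x)) → ∀ t → cpsᴱ ρ κ (subμ σ t) ≈λ cpsᴱ ρ' κ t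
cpsᴱC-subμ : ∀ {n n' m N} (σ : Fin n → Tmμ n' m) (ρ : Fin n' → Tm N) (ρ' : Fin n → Tm N) (κ : Fin m → Tm N)
  → (∀ x → η-exp (ρ' x) ≈λ cpsᴱ ρ κ (σ x)) → ∀ c → cpsᴱC ρ κ (subμC σ c) ≈λ cpsᴱC ρ' κ c
cpsᴱ-subμ σ ρ ρ' κ h (var x) = ≈-sym (h x)
cpsᴱ-subμ σ ρ ρ' κ h (lam t) =
  lam-cong (app-congR (lam-cong (cpsᴱ-subμ (extsμ σ) (extVal ρ) (extVal ρ') (wk ∘ wk ∘ κ) h' t)))
  where
    h' : ∀ x → η-exp (extVal ρ' x) ≈λ cpsᴱ (extVal ρ) (wk ∘ wk ∘ κ) (extsμ σ x)
    h' zero = ε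
    h' (suc i) =
      ≡⇒≈ (sym (trans (cong wk (wk-η-exp (ρ' i))) (wk-η-exp (wk (ρ' i)))))
      ◅◅ ≈-wk (≈-wk (h i))
      ◅◅ ≡⇒≈ (trans (cong wk (wk-cpsᴱ ρ κ (σ i))) (trans (wk-cpsᴱ (wk ∘ ρ) (wk ∘ κ) (σ i))
               (sym (cpsᴱ-renμ (λ _ → refl) (λ _ → refl) (σ i)))))
cpsᴱ-subμ σ ρ ρ' κ h (app t r) = •-cong (cpsᴱ-subμ σ ρ ρ' κ h t) (cpsᴱ-subμ σ ρ ρ' κ h r)
cpsᴱ-subμ σ ρ ρ' κ h (mu c) = lam-cong (cpsᴱC-subμ (wkμ ∘ σ) (wk ∘ ρ) (wk ∘ ρ') (extCont κ) h' c)
  where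
    h' : ∀ x → η-exp (wk (ρ' x)) ≈λ cpsᴱ (wk ∘ ρ) (extCont κ) (wkμ (σ x))
    h' x = ≡⇒≈ (sym (wk-η-exp (ρ' x))) ◅◅ ≈-wk (h x) ◅◅ ≡⇒≈ (sym (cpsᴱ-wkμ ρ κ (σ x)))
cpsᴱ-subμ σ ρ ρ' κ h zer = ε
cpsᴱ-subμ σ ρ ρ' κ h (S t) = lam-cong (app-congL (≈-wk (cpsᴱ-subμ σ ρ ρ' κ h t)))
cpsᴱ-subμ σ ρ ρ' κ h (nrec r s t) =
  lam-cong (app-cong (≈-wk (cpsᴱ-subμ σ ρ ρ' κ h t))
    (lam-cong (app-congL (nrec-cong (≈-wk (≈-wk (cpsᴱ-subμ σ ρ ρ' κ h r)))
                                    (≈-wk (≈-wk (nrecStep-cong (cpsᴱ-subμ σ ρ ρ' κ h s)))) ε))))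
cpsᴱC-subμ σ ρ ρ' κ h (named α t) = app-congL (cpsᴱ-subμ σ ρ ρ' κ h t)

-- The continuation cont ρ κ E k of an evaluation context E around an outer
-- continuation k: the continuation under which the hole is evaluated.
cont : ∀ {n m N} → (Fin n → Tm N) → (Fin m → Tm N) → Ctx n m → Tm N → Tm N
cont ρ κ hole k = k
cont ρ κ (appC E t) k = cont ρ κ E (lam (app (app (var zero) (wk (cpsᴱ ρ κ t))) (wk k)))
cont ρ κ (SC E) k = cont ρ κ E (lam (app (wk k) (S (var zero))))
cont ρ κ (nrecC r s E) k =
  cont ρ κ E (lam (app (nrec (wk (cpsᴱ ρ κ r)) (wk (nrecStep (cpsᴱ ρ κ s))) (var zero)) (wk k)))

cont-plug : ∀ {n m N} (ρ : Fin n → Tm N) (κ : Fin m → Tm N) E q k →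
  app (cpsᴱ ρ κ (plug E q)) k ≈λ app (cpsᴱ ρ κ q) (cont ρ κ E k)
cont-plug ρ κ hole q k = ε
cont-plug ρ κ (appC E t) q k =
  βeq (cong₂ (λ a b → app a (lam (app (app (var zero) b) (wk k))))
        (sub0-wk k (cpsᴱ ρ κ (plug E q))) (sub0-wk² k (cpsᴱ ρ κ t)))
  ◅◅ cont-plug ρ κ E q _
cont-plug ρ κ (SC E) q k =
  βeq (cong (λ a → app a (lam (app (wk k) (S (var zero))))) (sub0-wk k (cpsᴱ ρ κ (plug E q))))
  ◅◅ cont-plug ρ κ E q _
cont-plug ρ κ (nrecC r s E) q k =
  βeq (cong₃ (λ a b c → app a (lam (app (nrec b c (var zero)) (wk k))))
        (sub0-wk k (cpsᴱ ρ κ (plug E q))) (sub0-wk² k (cpsᴱ ρ κ r)) (sub0-wk² k (nrecStep (cpsᴱ ρ κ s))))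
  ◅◅ cont-plug ρ κ E q _

sub-cont : ∀ {n m N N'} {τ : Fin N → Tm N'} {ρ : Fin n → Tm N} {κ : Fin m → Tm N}
  {ρ' : Fin n → Tm N'} {κ' : Fin m → Tm N'}
  → ρ' ≗ sub τ ∘ ρ → κ' ≗ sub τ ∘ κ → ∀ E k → sub τ (cont ρ κ E k) ≡ cont ρ' κ' E (sub τ k)
sub-cont hρ hκ hole k = refl
sub-cont {τ = τ} {ρ} {κ} {ρ'} {κ'} hρ hκ (appC E t) k =
  trans (sub-cont hρ hκ E _) (cong (cont ρ' κ' E)
    (cong₂ (λ a b → lam (app (app (var zero) a) b))
       (trans (sub-exts-wk τ (cpsᴱ ρ κ t)) (cong wk (sub-cpsᴱ hρ hκ t))) (sub-exts-wk τ k)))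
sub-cont {τ = τ} {ρ} {κ} {ρ'} {κ'} hρ hκ (SC E) k =
  trans (sub-cont hρ hκ E _) (cong (cont ρ' κ' E)
    (cong (λ b → lam (app b (S (var zero)))) (sub-exts-wk τ k)))
sub-cont {τ = τ} {ρ} {κ} {ρ'} {κ'} hρ hκ (nrecC r s E) k =
  trans (sub-cont hρ hκ E _) (cong (cont ρ' κ' E)
    (cong₃ (λ a b c → lam (app (nrec a b (var zero)) c))
       (trans (sub-exts-wk τ (cpsᴱ ρ κ r)) (cong wk (sub-cpsᴱ hρ hκ r)))
       (trans (sub-exts-wk τ (nrecStep (cpsᴱ ρ κ s)))
              (cong wk (trans (sub-nrecStep τ (cpsᴱ ρ κ s)) (cong nrecStep (sub-cpsᴱ hρ hκ s)))))
       (sub-exts-wk τ k)))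

wk-cont : ∀ {n m N} (ρ : Fin n → Tm N) (κ : Fin m → Tm N) E k →
  wk (cont ρ κ E k) ≡ cont (wk ∘ ρ) (wk ∘ κ) E (wk k)
wk-cont ρ κ E k =
  trans (wk≡sub (cont ρ κ E k))
    (trans (sub-cont (λ x → wk≡sub (ρ x)) (λ x → wk≡sub (κ x)) E k)
           (cong (cont (wk ∘ ρ) (wk ∘ κ) E) (sym (wk≡sub k))))

cont-renCtx : ∀ {n n' m m' N} {π : Fin n → Fin n'} {θ : Fin m → Fin m'}
  {ρ : Fin n' → Tm N} {κ : Fin m' → Tm N} {ρ' : Fin n → Tm N} {κ' : Fin m → Tm N}
  → ρ' ≗ ρ ∘ π → κ' ≗ κ ∘ θ → ∀ E k → cont ρ κ (renCtx π θ E) k ≡ cont ρ' κ' E k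
cont-renCtx hρ hκ hole k = refl
cont-renCtx {ρ' = ρ'} {κ'} hρ hκ (appC E t) k =
  trans (cont-renCtx hρ hκ E _)
    (cong (λ z → cont ρ' κ' E (lam (app (app (var zero) (wk z)) (wk k)))) (cpsᴱ-renμ hρ hκ t))
cont-renCtx hρ hκ (SC E) k = cont-renCtx hρ hκ E _
cont-renCtx {ρ' = ρ'} {κ'} hρ hκ (nrecC r s E) k =
  trans (cont-renCtx hρ hκ E _)
    (cong₂ (λ a b → cont ρ' κ' E (lam (app (nrec (wk a) (wk (nrecStep b)) (var zero)) (wk k))))
       (cpsᴱ-renμ hρ hκ r) (cpsᴱ-renμ hρ hκ s))

contEnv : ∀ {n m m' N} → (Fin n → Tm N) → (Fin m' → Tm N) → SSub n m m' → Fin m → Tm N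
contEnv ρ κ σ α = cont ρ κ (proj₂ (σ α)) (κ (proj₁ (σ α)))

-- Structural substitution: translating t[α := β E] is translating t with
-- k_α bound to the continuation of E around k_β.
cpsᴱ-ssub  : ∀ {n m m' N} (σ : SSub n m m') (ρ : Fin n → Tm N) (κ : Fin m' → Tm N) (κ₀ : Fin m → Tm N)
  → κ₀ ≗ contEnv ρ κ σ → ∀ t → cpsᴱ ρ κ (ssub σ t) ≈λ cpsᴱ ρ κ₀ t
cpsᴱC-ssub : ∀ {n m m' N} (σ : SSub n m m') (ρ : Fin n → Tm N) (κ : Fin m' → Tm N) (κ₀ : Fin m → Tm N)
  → κ₀ ≗ contEnv ρ κ σ → ∀ c → cpsᴱC ρ κ (ssubC σ c) ≈λ cpsᴱC ρ κ₀ c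
cpsᴱ-ssub σ ρ κ κ₀ h (var x) = ε
cpsᴱ-ssub σ ρ κ κ₀ h (lam t) =
  lam-cong (app-congR (lam-cong (cpsᴱ-ssub (liftλ σ) (extVal ρ) (wk ∘ wk ∘ κ) (wk ∘ wk ∘ κ₀) h' t)))
  where
    h' : (wk ∘ wk ∘ κ₀) ≗ contEnv (extVal ρ) (wk ∘ wk ∘ κ) (liftλ σ)
    h' α = trans (cong (wk ∘ wk) (h α))
      (trans (cong wk (wk-cont ρ κ (proj₂ (σ α)) _))
        (trans (wk-cont (wk ∘ ρ) (wk ∘ κ) (proj₂ (σ α)) _)
          (sym (cont-renCtx (λ _ → refl) (λ _ → refl) (proj₂ (σ α)) _))))
cpsᴱ-ssub σ ρ κ κ₀ h (app t r) = •-cong (cpsᴱ-ssub σ ρ κ κ₀ h t) (cpsᴱ-ssub σ ρ κ κ₀ h r)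
cpsᴱ-ssub σ ρ κ κ₀ h (mu c) = lam-cong (cpsᴱC-ssub (liftμ σ) (wk ∘ ρ) (extCont κ) (extCont κ₀) h' c)
  where
    h' : extCont κ₀ ≗ contEnv (wk ∘ ρ) (extCont κ) (liftμ σ)
    h' zero = refl
    h' (suc α) = trans (cong wk (h α))
      (trans (wk-cont ρ κ (proj₂ (σ α)) _)
        (sym (cont-renCtx (λ _ → refl) (λ _ → refl) (proj₂ (σ α)) _)))
cpsᴱ-ssub σ ρ κ κ₀ h zer = ε
cpsᴱ-ssub σ ρ κ κ₀ h (S t) = lam-cong (app-congL (≈-wk (cpsᴱ-ssub σ ρ κ κ₀ h t)))
cpsᴱ-ssub σ ρ κ κ₀ h (nrec r s t) =
  lam-cong (app-cong (≈-wk (cpsᴱ-ssub σ ρ κ κ₀ h t))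
    (lam-cong (app-congL (nrec-cong (≈-wk (≈-wk (cpsᴱ-ssub σ ρ κ κ₀ h r)))
                                    (≈-wk (≈-wk (nrecStep-cong (cpsᴱ-ssub σ ρ κ κ₀ h s)))) ε))))
cpsᴱC-ssub σ ρ κ κ₀ h (named α t) =
  cont-plug ρ κ (proj₂ (σ α)) (ssub σ t) (κ (proj₁ (σ α)))
  ◅◅ app-cong (cpsᴱ-ssub σ ρ κ κ₀ h t) (≡⇒≈ (sym (h α)))

-- 6. Simulation of the reduction rules

-- β: the argument's translation R becomes the value of the bound variable.
sim-β : ∀ {n m N} (ρ : Fin n → Tm N) (κ : Fin m → Tm N) t r →
  cpsᴱ ρ κ (app (lam t) r) ≈λ cpsᴱ ρ κ (subμ (sub0μ r) t)
sim-β ρ κ t r = begin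
  cpsᴱ ρ κ (app (lam t) r)     ≈⟨ lam-cong body ⟩
  η-exp (cpsᴱ (R ▸ ρ) κ t)     ≈⟨ η-exp-cpsᴱ (R ▸ ρ) κ t ⟩
  cpsᴱ (R ▸ ρ) κ t             ≈⟨ cpsᴱ-subμ (sub0μ r) ρ (R ▸ ρ) κ arg t ⟨
  cpsᴱ ρ κ (subμ (sub0μ r) t)  ∎
  where
    open ≈-Reasoning
    R = cpsᴱ ρ κ r
    T = cpsᴱ (extVal ρ) (wk ∘ wk ∘ κ) t
    Kont = lam (app (app (var zero) (wk (wk R))) (var (suc zero)))
    T' = sub (exts (replace₀ Kont)) T
    φ = sub (sub0 (wk R)) ∘ exts (replace₀ Kont)
    φ-wk² : ∀ X → wk X ≡ sub φ (wk (wk X))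
    φ-wk² X = sym (trans (sub-ren (λ _ → refl) (wk X)) (trans (sub-ren (λ _ → refl) X) (sym (wk≡sub X))))
    φ-ρ : (wk ∘ (R ▸ ρ)) ≗ sub φ ∘ extVal ρ
    φ-ρ zero = refl
    φ-ρ (suc i) = φ-wk² (ρ i)
    T'-eq : sub (sub0 (wk R)) T' ≡ wk (cpsᴱ (R ▸ ρ) κ t)
    T'-eq = trans (sub-sub (λ _ → refl) T)
              (trans (sub-cpsᴱ φ-ρ (λ α → φ-wk² (κ α)) t) (sym (wk-cpsᴱ (R ▸ ρ) κ t)))
    body : app (wk (cpsᴱ ρ κ (lam t))) Kont ≈λ app (wk (cpsᴱ (R ▸ ρ) κ t)) (var zero)
    body = begin
      app (wk (cpsᴱ ρ κ (lam t))) Kont        ≈⟨ wkβ _ Kont ⟩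
      app Kont (lam T')                        ≈⟨ βeq (cong (λ z → app (app (lam T') z) (var zero)) (sub0-wk (lam T') (wk R))) ⟩
      app (app (lam T') (wk R)) (var zero)     ≈⟨ app-congL (βeq T'-eq) ⟩
      app (wk (cpsᴱ (R ▸ ρ) κ t)) (var zero)  ∎
    arg : ∀ x → η-exp ((R ▸ ρ) x) ≈λ cpsᴱ ρ κ (sub0μ r x)
    arg zero = η-exp-cpsᴱ ρ κ r
    arg (suc i) = ε

-- S (μα.c), (μα.c) s and nrec r s (μα.c): the translation of the μ-term is
-- applied to the continuation Kont of the one-layer context E, and the
-- resulting β-step performs the structural substitution c[α := α E].
sim-μ : ∀ {n m N} (ρ : Fin n → Tm N) (κ : Fin m → Tm N) (c : Cmd n (suc m)) (E : Ctx n (suc m))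
  (Kont : Tm (suc N)) → Kont ≡ cont (wk ∘ ρ) (extCont κ) E (var zero)
  → lam (app (wk (cpsᴱ ρ κ (mu c))) Kont) ≈λ cpsᴱ ρ κ (mu (ssubC (ssubSelf E) c))
sim-μ ρ κ c E Kont eq =
  lam-cong (wkβ (cpsᴱC (wk ∘ ρ) (extCont κ) c) Kont
    ◅◅ ≡⇒≈ (sub-cpsᴱC hρ hκ c)
    ◅◅ ≈-sym (cpsᴱC-ssub (ssubSelf E) (wk ∘ ρ) (extCont κ) κ₁ h c))
  where
    κ₁ = Kont ▸ (wk ∘ κ)
    hρ : (wk ∘ ρ) ≗ sub (replace₀ Kont) ∘ (wk ∘ ρ)
    hρ x = sym (replace₀-wk Kont (ρ x))
    hκ : κ₁ ≗ sub (replace₀ Kont) ∘ extCont κ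
    hκ zero = refl
    hκ (suc γ) = sym (replace₀-wk Kont (κ γ))
    h : κ₁ ≗ contEnv (wk ∘ ρ) (extCont κ) (ssubSelf E)
    h zero = eq
    h (suc γ) = refl

-- μα.[α]t with α not free in t: an η-expansion of t*.
sim-μη : ∀ {n m N} (ρ : Fin n → Tm N) (κ : Fin m → Tm N) t →
  cpsᴱ ρ κ (mu (named zero (wkμ t))) ≈λ cpsᴱ ρ κ t
sim-μη ρ κ t = ≡⇒≈ (cong (λ z → lam (app z (var zero))) (cpsᴱ-wkμ ρ κ t)) ◅◅ η-exp-cpsᴱ ρ κ t

-- [α]μβ.c: the β-step binding k_β to k_α is the renaming c[β := α □].
sim-μcmd : ∀ {n m N} (ρ : Fin n → Tm N) (κ : Fin m → Tm N) α c →
  cpsᴱC ρ κ (named α (mu c)) ≈λ cpsᴱC ρ κ (ssubC (ssubTo α) c)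
sim-μcmd ρ κ α c =
  βeq (sub-cpsᴱC hρ hκ c) ◅◅ ≈-sym (cpsᴱC-ssub (ssubTo α) ρ κ (κ α ▸ κ) h c)
  where
    hρ : ρ ≗ sub (sub0 (κ α)) ∘ (wk ∘ ρ)
    hρ x = sym (sub0-wk (κ α) (ρ x))
    hκ : (κ α ▸ κ) ≗ sub (sub0 (κ α)) ∘ extCont κ
    hκ zero = refl
    hκ (suc γ) = sym (sub0-wk (κ α) (κ γ))
    h : (κ α ▸ κ) ≗ contEnv ρ κ (ssubTo α)
    h zero = refl
    h (suc γ) = refl

cpsᴱ-nrec-num : ∀ {n m N} (ρ : Fin n → Tm N) (κ : Fin m → Tm N) r s k →
  cpsᴱ ρ κ (nrec r s (num k)) ≈λ η-exp (nrec (cpsᴱ ρ κ r) (nrecStep (cpsᴱ ρ κ s)) (numeral k))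
cpsᴱ-nrec-num ρ κ r s k = lam-cong (begin
    app (wk (cpsᴱ ρ κ (num k))) Kont             ≈⟨ app-congL (≈-wk (cpsᴱ-num ρ κ k)) ⟩
    app (wk (dbl (numeral k))) Kont              ≡⟨ cong (λ z → app z Kont) (trans (wk-dbl _) (cong dbl (wk-numeral k))) ⟩
    app (dbl (numeral k)) Kont                   ≈⟨ dbl-β (numeral k) Kont ⟩
    app Kont (numeral k)                         ≈⟨ βeq (cong₂ (λ a b → app (nrec a b (numeral k)) (var zero))
                                                          (sub0-wk (numeral k) (wk R)) (sub0-wk (numeral k) (wk s'))) ⟩
    app (nrec (wk R) (wk s') (numeral k)) (var zero) ≡⟨ cong (λ z → app (nrec (wk R) (wk s') z) (var zero)) (wk-numeral k) ⟨
    app (wk (nrec R s' (numeral k))) (var zero)  ∎)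
  where
    open ≈-Reasoning
    R = cpsᴱ ρ κ r
    s' = nrecStep (cpsᴱ ρ κ s)
    Kont = lam (app (nrec (wk (wk R)) (wk (wk s')) (var zero)) (var (suc zero)))

sim-nrec0 : ∀ {n m N} (ρ : Fin n → Tm N) (κ : Fin m → Tm N) r s →
  cpsᴱ ρ κ (nrec r s zer) ≈λ cpsᴱ ρ κ r
sim-nrec0 ρ κ r s =
  cpsᴱ-nrec-num ρ κ r s 0 ◅◅ η-exp-cong (≈-step nrec0) ◅◅ η-exp-cpsᴱ ρ κ r

-- nrec r s (S n̄): one λT recursion step followed by the β-rule of s', and
-- the recursive call is an abstraction, so its η-expansion is harmless.
sim-nrecS : ∀ {n m N} (ρ : Fin n → Tm N) (κ : Fin m → Tm N) r s k →
  cpsᴱ ρ κ (nrec r s (S (num k))) ≈λ cpsᴱ ρ κ (app (app s (num k)) (nrec r s (num k)))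
sim-nrecS ρ κ r s k = begin
  cpsᴱ ρ κ (nrec r s (S (num k)))           ≈⟨ cpsᴱ-nrec-num ρ κ r s (suc k) ⟩
  η-exp (nrec R s' (S (numeral k)))         ≈⟨ η-exp-cong (≈-step nrecS) ⟩
  η-exp (app (app s' (numeral k)) N₀)       ≈⟨ η-exp-cong (nrecStep-β Sv (numeral k) N₀) ⟩
  η-exp ((Sv • dbl (numeral k)) • N₀)       ≈⟨ η-exp-lam _ ⟩
  (Sv • dbl (numeral k)) • N₀               ≈⟨ •-cong (•-cong ε (≈-sym (cpsᴱ-num ρ κ k))) N₀-≈ ⟩
  cpsᴱ ρ κ (app (app s (num k)) (nrec r s (num k))) ∎
  where
    open ≈-Reasoning
    R = cpsᴱ ρ κ r
    Sv = cpsᴱ ρ κ s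
    s' = nrecStep Sv
    N₀ = nrec R s' (numeral k)
    N₀-lam = nrec-numeral-lam R Sv (proj₁ (cpsᴱ-lam ρ κ r)) k (proj₂ (cpsᴱ-lam ρ κ r))
    N₀-≈ : N₀ ≈λ cpsᴱ ρ κ (nrec r s (num k))
    N₀-≈ = ≈-sym (η-exp-≈lam (proj₁ N₀-lam) (proj₂ N₀-lam)) ◅◅ ≈-sym (cpsᴱ-nrec-num ρ κ r s k)

sim  : ∀ {n m N} {t t' : Tmμ n m} → t ⟶μ t' → ∀ (ρ : Fin n → Tm N) κ → cpsᴱ ρ κ t ≈λ cpsᴱ ρ κ t'
simC : ∀ {n m N} {c c' : Cmd n m} → c ⟶c c' → ∀ (ρ : Fin n → Tm N) κ → cpsᴱC ρ κ c ≈λ cpsᴱC ρ κ c'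
sim (β {t} {r}) ρ κ = sim-β ρ κ t r
sim (μS {c}) ρ κ = sim-μ ρ κ c (SC hole) _ refl
sim (μapp {c} {s}) ρ κ = sim-μ ρ κ c (appC hole (wkμ s)) _
  (cong (λ z → lam (app (app (var zero) (wk z)) (var (suc zero)))) (sym (cpsᴱ-wkμ ρ κ s)))
sim (μη {t}) ρ κ = sim-μη ρ κ t
sim (nrec0 {r} {s}) ρ κ = sim-nrec0 ρ κ r s
sim (nrecS {r} {s} {k}) ρ κ = sim-nrecS ρ κ r s k
sim (μnrec {r} {s} {c}) ρ κ = sim-μ ρ κ c (nrecC (wkμ r) (wkμ s) hole) _
  (cong₂ (λ a b → lam (app (nrec (wk a) (wk b) (var zero)) (var (suc zero))))
     (sym (cpsᴱ-wkμ ρ κ r))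
     (trans (wk-nrecStep (cpsᴱ ρ κ s)) (cong nrecStep (sym (cpsᴱ-wkμ ρ κ s)))))
sim (ξlam p) ρ κ = lam-cong (app-congR (lam-cong (sim p _ _)))
sim (ξappL p) ρ κ = •-cong (sim p ρ κ) ε
sim (ξappR p) ρ κ = •-cong ε (sim p ρ κ)
sim (ξmu p) ρ κ = lam-cong (simC p _ _)
sim (ξS p) ρ κ = lam-cong (app-congL (≈-wk (sim p ρ κ)))
sim (ξnrec₁ p) ρ κ =
  lam-cong (app-congR (lam-cong (app-congL (nrec-cong (≈-wk (≈-wk (sim p ρ κ))) ε ε))))
sim (ξnrec₂ p) ρ κ =
  lam-cong (app-congR (lam-cong (app-congL (nrec-cong ε (≈-wk (≈-wk (nrecStep-cong (sim p ρ κ)))) ε))))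
sim (ξnrec₃ p) ρ κ = lam-cong (app-congL (≈-wk (sim p ρ κ)))
simC (μcmd {α} {c}) ρ κ = sim-μcmd ρ κ α c
simC (ξnamed p) ρ κ = app-congL (sim p ρ κ)

cps-step : ∀ {n m} {t t' : Tmμ n m} → t ⟶μ t' → (t *) ≈λ (t' *)
cps-step {n} {m} {t} {t'} p =
  subst₂ _≈λ_ (sym (cps≡cpsᴱ (λ _ → refl) (λ _ → refl) t)) (sym (cps≡cpsᴱ (λ _ → refl) (λ _ → refl) t'))
    (sim p (λ x → var (x ↑ˡ m)) (λ α → var (n ↑ʳ α)))

lemma4p12 : {n m : ℕ} (t₁ t₂ : Tmμ n m) → t₁ ≈μ t₂ → (t₁ *) ≈λ (t₂ *)
lemma4p12 t₁ t₂ = gfold (isEquivalence _⟶_) _* cps-step
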